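{- Let $\Theta_1,\ldots,\Theta_n$ be finite nonempty sets of formulae built from variables using only $\backslash$, $/$ and $\cdot$, and let $\gamma$ also be built using only $\backslash$, $/$, $\cdot$. Then $\bigwedge\Theta_1,\ldots,\bigwedge\Theta_n\vdash\gamma$ is derivable in $\mathbf{MALC}$ if and only if there exist $\theta_1\in\Theta_1,\ldots,\theta_n\in\Theta_n$ such that $\theta_1,\ldots,\theta_n\vdash\gamma$ is derivable in $\mathbf{MALC}$.
   Context: Formulae are built from propositional variables and constants $\mathbf{0},\mathbf{1}$ using binary connectives $\cdot$, $\backslash$, $/$, $\vee$, $\wedge$. For a finite set $\Xi=\{\xi_1,\dots,\xi_k\}$, $\bigwedge\Xi=\xi_1\wedge\dots\wedge\xi_k$ (order irrelevant up to equivalence). A sequent is $\Gamma\vdash\beta$ with $\Gamma$ a finite, possibly empty (denoted $\Lambda$), sequence of formulae. The calculus $\mathbf{MALC}$ (multiplicative-additive Lambek calculus, which admits cut elimination) has axioms $\alpha\vdash\alpha$, $\Gamma,\mathbf{0},\Delta\vdash\gamma$, $\Lambda\vdash\mathbf{1}$, and rules: from $\Gamma,\Delta\vdash\gamma$ infer $\Gamma,\mathbf{1},\Delta\vdash\gamma$; from $\Pi\vdash\alpha$ and $\Gamma,\beta,\Delta\vdash\gamma$ infer $\Gamma,\Pi,\alpha\backslash\beta,\Delta\vdash\gamma$ and also $\Gamma,\beta/\alpha,\Pi,\Delta\vdash\gamma$; from $\alpha,\Pi\vdash\beta$ infer $\Pi\vdash\alpha\backslash\beta$; from $\Pi,\alpha\vdash\beta$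 infer $\Pi\vdash\beta/\alpha$; from $\Gamma,\alpha,\beta,\Delta\vdash\gamma$ infer $\Gamma,\alpha\cdot\beta,\Delta\vdash\gamma$; from $\Gamma\vdash\alpha$ and $\Delta\vdash\beta$ infer $\Gamma,\Delta\vdash\alpha\cdot\beta$; from $\Gamma,\alpha_i,\Delta\vdash\gamma$ ($i=1,2$) infer $\Gamma,\alpha_1\wedge\alpha_2,\Delta\vdash\gamma$; from $\Pi\vdash\alpha_1$ and $\Pi\vdash\alpha_2$ infer $\Pi\vdash\alpha_1\wedge\alpha_2$; from $\Gamma,\alpha_1,\Delta\vdash\gamma$ and $\Gamma,\alpha_2,\Delta\vdash\gamma$ infer $\Gamma,\alpha_1\vee\alpha_2,\Delta\vdash\gamma$; from $\Pi\vdash\alpha_i$ ($i=1,2$) infer $\Pi\vdash\alpha_1\vee\alpha_2$. -}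

module Defs where

open import Data.Nat using (ℕ)
open import Data.List using (List; []; _∷_; _++_)
open import Data.List.NonEmpty using (List⁺; _∷_; foldr₁)

infixr 30 _·_
infixr 25 _∖_
infixl 25 _╱_
infixr 20 _∨_
infixr 20 _∧_

-- Formulae of MALC: variables, constants 0 and 1, connectives · \ / ∨ ∧.
-- A ∖ B is α\β, A ╱ B is β/α.
data Formula : Set where
  var : ℕ → Formula
  𝟎 𝟏 : Formula
  _·_ _∖_ _╱_ _∨_ _∧_ : Formula → Formula → Formula

data Mult : Formula → Set where
  var : ∀ p → Mult (var p)
  _·_ : ∀ {a b} → Mult a → Mult b → Mult (a · b)
  _∖_ : ∀ {a b} → Mult a → Mult b → Mult (a ∖ b)
  _╱_ : ∀ {a b} → Mult a → Mult b → Mult (a ╱ b)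

⋀ : List⁺ Formula → Formula
⋀ = foldr₁ _∧_

infix 5 _⊢_

data _⊢_ : List Formula → Formula → Set where
  ax   : ∀ {a} → (a ∷ []) ⊢ a
  0L   : ∀ {Γ Δ c} → (Γ ++ 𝟎 ∷ Δ) ⊢ c
  1R   : [] ⊢ 𝟏
  1L   : ∀ {Γ Δ c} → (Γ ++ Δ) ⊢ c → (Γ ++ 𝟏 ∷ Δ) ⊢ c
  ∖L   : ∀ {Π Γ Δ a b c} → Π ⊢ a → (Γ ++ b ∷ Δ) ⊢ c →
         (Γ ++ Π ++ (a ∖ b) ∷ Δ) ⊢ c
  ╱L   : ∀ {Π Γ Δ a b c} → Π ⊢ a → (Γ ++ b ∷ Δ) ⊢ c →
         (Γ ++ (b ╱ a) ∷ Π ++ Δ) ⊢ c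
  ∖R   : ∀ {Π a b} → (a ∷ Π) ⊢ b → Π ⊢ a ∖ b
  ╱R   : ∀ {Π a b} → (Π ++ a ∷ []) ⊢ b → Π ⊢ b ╱ a
  ·L   : ∀ {Γ Δ a b c} → (Γ ++ a ∷ b ∷ Δ) ⊢ c → (Γ ++ (a · b) ∷ Δ) ⊢ c
  ·R   : ∀ {Γ Δ a b} → Γ ⊢ a → Δ ⊢ b → (Γ ++ Δ) ⊢ a · b
  ∧L₁  : ∀ {Γ Δ a₁ a₂ c} → (Γ ++ a₁ ∷ Δ) ⊢ c → (Γ ++ (a₁ ∧ a₂) ∷ Δ) ⊢ c
  ∧L₂  : ∀ {Γ Δ a₁ a₂ c} → (Γ ++ a₂ ∷ Δ) ⊢ c → (Γ ++ (a₁ ∧ a₂) ∷ Δ) ⊢ c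
  ∧R   : ∀ {Π a₁ a₂} → Π ⊢ a₁ → Π ⊢ a₂ → Π ⊢ a₁ ∧ a₂
  ∨L   : ∀ {Γ Δ a₁ a₂ c} → (Γ ++ a₁ ∷ Δ) ⊢ c → (Γ ++ a₂ ∷ Δ) ⊢ c →
         (Γ ++ (a₁ ∨ a₂) ∷ Δ) ⊢ c
  ∨R₁  : ∀ {Π a₁ a₂} → Π ⊢ a₁ → Π ⊢ a₁ ∨ a₂
  ∨R₂  : ∀ {Π a₁ a₂} → Π ⊢ a₂ → Π ⊢ a₁ ∨ a₂

-- Call a formula a ∧-combination of multiplicative formulae if it is a
-- ∧-tree whose leaves are built from variables with ·, \, /.  In a cut-free
-- derivation of a multiplicative succedent from such antecedents no rule can
-- introduce 0, 1, ∨ or a right ∧, so the only rules touching a ∧ are the ∧L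
-- rules, each of which selects one conjunct.  Tracing every antecedent
-- formula up the derivation therefore picks one leaf of it, and erasing the
-- ∧L steps leaves a derivation from the chosen leaves.  Conversely, ∧L
-- recovers the conjunctions from any choice of leaves.

module Submission where

open import Defs
open import Data.List using (List; map; []; _∷_; _++_)
open import Data.List.NonEmpty using (List⁺; toList; _∷_)
open import Data.List.Relation.Unary.All as All using (All; []; _∷_)
open import Data.List.Relation.Unary.All.Properties as Allₚ using (++⁻; map⁺)
open import Data.List.Relation.Binary.Pointwise using (Pointwise; []; _∷_; ++⁺)
open import Data.List.Membership.Propositional using (_∈_)
open import Data.List.Relation.Unary.Any using (here; there)
open import Data.List.Properties using (++-assoc)
open import Data.Product using (Σ; _×_; _,_; ∃-syntax; map₁; map₂)
open import Function using (_∘_)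
open import Function.Bundles using (_⇔_; mk⇔; Equivalence)
open import Relation.Binary.PropositionalEquality using (_≡_; refl; subst; sym)

data ∧Mult : Formula → Set where
  mult : ∀ {a} → Mult a → ∧Mult a
  _∧_  : ∀ {a b} → ∧Mult a → ∧Mult b → ∧Mult (a ∧ b)

-- Leaves must be multiplicative, so a conjunction is never its own conjunct.
data Conjunct : Formula → Formula → Set where
  leaf : ∀ {a} → Mult a → Conjunct a a
  ∧ˡ   : ∀ {θ a b} → Conjunct θ a → Conjunct θ (a ∧ b)
  ∧ʳ   : ∀ {θ a b} → Conjunct θ b → Conjunct θ (a ∧ b)

Conjunct-Mult : ∀ {θ a} → Mult a → Conjunct θ a → θ ≡ a
Conjunct-Mult _ (leaf _) = refl

Choice : List Formula → Formula → Set
Choice Γ c = ∃[ θs ] Pointwise Conjunct θs Γ × θs ⊢ c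

∧L⋆ : ∀ {θ a Γ Δ c} → Conjunct θ a → (Γ ++ θ ∷ Δ) ⊢ c → (Γ ++ a ∷ Δ) ⊢ c
∧L⋆             (leaf _) d = d
∧L⋆ {Γ = Γ} {Δ} (∧ˡ p)   d = ∧L₁ {Γ = Γ} {Δ} (∧L⋆ p d)
∧L⋆ {Γ = Γ} {Δ} (∧ʳ p)   d = ∧L₂ {Γ = Γ} {Δ} (∧L⋆ p d)

∧L⋆-++ : ∀ Π {θs Γ c} → Pointwise Conjunct θs Γ → (Π ++ θs) ⊢ c → (Π ++ Γ) ⊢ c
∧L⋆-++ Π []       d = d
∧L⋆-++ Π {θ ∷ θs} {a ∷ Γ} (p ∷ ps) d =
  subst (_⊢ _) (++-assoc Π (a ∷ []) Γ)
    (∧L⋆-++ (Π ++ a ∷ []) ps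
      (subst (_⊢ _) (sym (++-assoc Π (a ∷ []) θs)) (∧L⋆ {Γ = Π} p d)))

choice-sound : ∀ {Γ c} → Choice Γ c → Γ ⊢ c
choice-sound (_ , ps , d) = ∧L⋆-++ [] ps d

data Split (Γ : List Formula) (x : Formula) (Δ : List Formula) : List Formula → Set where
  split : ∀ {θΓ θΔ} → Pointwise Conjunct θΓ Γ → Pointwise Conjunct θΔ Δ →
          Split Γ x Δ (θΓ ++ x ∷ θΔ)

split-at : ∀ Γ {x Δ θs} → Mult x → Pointwise Conjunct θs (Γ ++ x ∷ Δ) → Split Γ x Δ θs
split-at []      mx (p ∷ ps) with refl ← Conjunct-Mult mx p = split [] ps
split-at (_ ∷ Γ) mx (p ∷ ps) with split-at Γ mx ps
... | split pΓ pΔ = split (p ∷ pΓ) pΔ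

Pointwise-middle : ∀ {A B : Set} {R : A → B → Set} Γ {x y Δ θs} → (∀ {θ} → R θ x → R θ y) →
                   Pointwise R θs (Γ ++ x ∷ Δ) → Pointwise R θs (Γ ++ y ∷ Δ)
Pointwise-middle []      f (p ∷ ps) = f p ∷ ps
Pointwise-middle (_ ∷ Γ) f (p ∷ ps) = p ∷ Pointwise-middle Γ f ps

choice-∖L : ∀ {Π Γ Δ a b c} → Mult a → Mult b → Choice Π a → Choice (Γ ++ b ∷ Δ) c →
            Choice (Γ ++ Π ++ (a ∖ b) ∷ Δ) c
choice-∖L {Γ = Γ} ma mb (_ , pΠ , dΠ) (_ , ps , d) with split-at Γ mb ps
... | split {θΓ} {θΔ} pΓ pΔ =
  _ , ++⁺ pΓ (++⁺ pΠ (leaf (ma ∖ mb) ∷ pΔ)) , ∖L {Γ = θΓ} {Δ = θΔ} dΠ d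

choice-╱L : ∀ {Π Γ Δ a b c} → Mult a → Mult b → Choice Π a → Choice (Γ ++ b ∷ Δ) c →
            Choice (Γ ++ (b ╱ a) ∷ Π ++ Δ) c
choice-╱L {Γ = Γ} ma mb (_ , pΠ , dΠ) (_ , ps , d) with split-at Γ mb ps
... | split {θΓ} {θΔ} pΓ pΔ =
  _ , ++⁺ pΓ (leaf (mb ╱ ma) ∷ ++⁺ pΠ pΔ) , ╱L {Γ = θΓ} {Δ = θΔ} dΠ d

choice-·L : ∀ {Γ Δ a b c} → Mult a → Mult b → Choice (Γ ++ a ∷ b ∷ Δ) c →
            Choice (Γ ++ (a · b) ∷ Δ) c
choice-·L {Γ = Γ} ma mb (_ , ps , d) with split-at Γ ma ps
... | split {θΓ} pΓ (p ∷ pΔ) with refl ← Conjunct-Mult mb p =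
  _ , ++⁺ pΓ (leaf (ma · mb) ∷ pΔ) , ·L {Γ = θΓ} d

choice-∖R : ∀ {Π a b} → Mult a → Choice (a ∷ Π) b → Choice Π (a ∖ b)
choice-∖R ma (_ ∷ θΠ , p ∷ pΠ , d) with refl ← Conjunct-Mult ma p = θΠ , pΠ , ∖R d

choice-╱R : ∀ {Π a b} → Mult a → Choice (Π ++ a ∷ []) b → Choice Π (b ╱ a)
choice-╱R {Π} ma (_ , ps , d) with split-at Π ma ps
... | split pΠ [] = _ , pΠ , ╱R d

choice-·R : ∀ {Γ Δ a b} → Choice Γ a → Choice Δ b → Choice (Γ ++ Δ) (a · b)
choice-·R (_ , pΓ , dΓ) (_ , pΔ , dΔ) = _ , ++⁺ pΓ pΔ , ·R dΓ dΔ

choice-∧L₁ : ∀ Γ {Δ a₁ a₂ c} → Choice (Γ ++ a₁ ∷ Δ) c → Choice (Γ ++ (a₁ ∧ a₂) ∷ Δ) c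
choice-∧L₁ Γ = map₂ (map₁ (Pointwise-middle Γ ∧ˡ))

choice-∧L₂ : ∀ Γ {Δ a₁ a₂ c} → Choice (Γ ++ a₂ ∷ Δ) c → Choice (Γ ++ (a₁ ∧ a₂) ∷ Δ) c
choice-∧L₂ Γ = map₂ (map₁ (Pointwise-middle Γ ∧ʳ))

choice-complete : ∀ {Γ c} → All ∧Mult Γ → Mult c → Γ ⊢ c → Choice Γ c
choice-complete _   mc ax = _ , leaf mc ∷ [] , ax
choice-complete hΓ  _  (0L {Γ}) with _ , mult () ∷ _ ← ++⁻ Γ hΓ
choice-complete hΓ  _  (1L {Γ} _) with _ , mult () ∷ _ ← ++⁻ Γ hΓ
choice-complete hΓ  _  (∨L {Γ} _ _) with _ , mult () ∷ _ ← ++⁻ Γ hΓ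
choice-complete hΓ  mc (∖L {Π} {Γ} dΠ d)
  with hΓ′ , hΠΔ ← ++⁻ Γ hΓ
  with hΠ , mult (ma ∖ mb) ∷ hΔ ← ++⁻ Π hΠΔ =
  choice-∖L ma mb (choice-complete hΠ ma dΠ) (choice-complete (Allₚ.++⁺ hΓ′ (mult mb ∷ hΔ)) mc d)
choice-complete hΓ  mc (╱L {Π} {Γ} dΠ d)
  with hΓ′ , mult (mb ╱ ma) ∷ hΠΔ ← ++⁻ Γ hΓ
  with hΠ , hΔ ← ++⁻ Π hΠΔ =
  choice-╱L ma mb (choice-complete hΠ ma dΠ) (choice-complete (Allₚ.++⁺ hΓ′ (mult mb ∷ hΔ)) mc d)
choice-complete hΓ  mc (·L {Γ} d)
  with hΓ′ , mult (ma · mb) ∷ hΔ ← ++⁻ Γ hΓ =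
  choice-·L ma mb (choice-complete (Allₚ.++⁺ hΓ′ (mult ma ∷ mult mb ∷ hΔ)) mc d)
choice-complete hΓ  (ma ∖ mb) (∖R d) = choice-∖R ma (choice-complete (mult ma ∷ hΓ) mb d)
choice-complete hΓ  (mb ╱ ma) (╱R d) = choice-╱R ma (choice-complete (Allₚ.++⁺ hΓ (mult ma ∷ [])) mb d)
choice-complete hΓ  (ma · mb) (·R {Γ} d₁ d₂)
  with hΓ₁ , hΓ₂ ← ++⁻ Γ hΓ = choice-·R (choice-complete hΓ₁ ma d₁) (choice-complete hΓ₂ mb d₂)
choice-complete hΓ  mc (∧L₁ {Γ} d)
  with hΓ′ , (h₁ ∧ _) ∷ hΔ ← ++⁻ Γ hΓ = choice-∧L₁ Γ (choice-complete (Allₚ.++⁺ hΓ′ (h₁ ∷ hΔ)) mc d)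
choice-complete hΓ  mc (∧L₂ {Γ} d)
  with hΓ′ , (_ ∧ h₂) ∷ hΔ ← ++⁻ Γ hΓ = choice-∧L₂ Γ (choice-complete (Allₚ.++⁺ hΓ′ (h₂ ∷ hΔ)) mc d)

⋀-∧Mult : ∀ (Θ : List⁺ Formula) → All Mult (toList Θ) → ∧Mult (⋀ Θ)
⋀-∧Mult (_ ∷ [])     (h ∷ [])  = mult h
⋀-∧Mult (_ ∷ y ∷ ys) (h ∷ hs) = mult h ∧ ⋀-∧Mult (y ∷ ys) hs

Conjunct-⋀⇔∈ : ∀ (Θ : List⁺ Formula) {θ} → All Mult (toList Θ) → Conjunct θ (⋀ Θ) ⇔ θ ∈ toList Θ
Conjunct-⋀⇔∈ Θ hΘ = mk⇔ (to Θ hΘ) (from Θ hΘ)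
  where
  to : ∀ (Θ : List⁺ Formula) {θ} → All Mult (toList Θ) → Conjunct θ (⋀ Θ) → θ ∈ toList Θ
  to (_ ∷ [])     (h ∷ [])  p        = here (Conjunct-Mult h p)
  to (_ ∷ _ ∷ _)  (h ∷ _)   (∧ˡ p)   = here (Conjunct-Mult h p)
  to (_ ∷ y ∷ ys) (_ ∷ hs)  (∧ʳ p)   = there (to (y ∷ ys) hs p)
  from : ∀ (Θ : List⁺ Formula) {θ} → All Mult (toList Θ) → θ ∈ toList Θ → Conjunct θ (⋀ Θ)
  from (_ ∷ [])     (h ∷ [])  (here refl) = leaf h
  from (_ ∷ _ ∷ _)  (h ∷ _)   (here refl) = ∧ˡ (leaf h)
  from (_ ∷ y ∷ ys) (_ ∷ hs)  (there p)   = ∧ʳ (from (y ∷ ys) hs p)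

Conjuncts-⋀⇔∈ : ∀ Θs {θs} → All (λ Θ → All Mult (toList Θ)) Θs →
                Pointwise Conjunct θs (map ⋀ Θs) ⇔ Pointwise (λ θ Θ → θ ∈ toList Θ) θs Θs
Conjuncts-⋀⇔∈ Θs hΘs = mk⇔ (to Θs hΘs) (from Θs hΘs)
  where
  to : ∀ Θs {θs} → All (λ Θ → All Mult (toList Θ)) Θs →
       Pointwise Conjunct θs (map ⋀ Θs) → Pointwise (λ θ Θ → θ ∈ toList Θ) θs Θs
  to []       []         []       = []
  to (Θ ∷ Θs) (hΘ ∷ hΘs) (p ∷ ps) = Equivalence.to (Conjunct-⋀⇔∈ Θ hΘ) p ∷ to Θs hΘs ps
  from : ∀ Θs {θs} → All (λ Θ → All Mult (toList Θ)) Θs →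
         Pointwise (λ θ Θ → θ ∈ toList Θ) θs Θs → Pointwise Conjunct θs (map ⋀ Θs)
  from []       []         []       = []
  from (Θ ∷ Θs) (hΘ ∷ hΘs) (p ∷ ps) = Equivalence.from (Conjunct-⋀⇔∈ Θ hΘ) p ∷ from Θs hΘs ps

lemma4 : (Θs : List (List⁺ Formula)) → (γ : Formula) →
         All (λ Θ → All Mult (toList Θ)) Θs → Mult γ →
         (map ⋀ Θs ⊢ γ) ⇔
           (Σ (List Formula) λ θs →
             Pointwise (λ θ Θ → θ ∈ toList Θ) θs Θs × (θs ⊢ γ))
lemma4 Θs γ hΘs hγ = mk⇔
  (map₂ (map₁ (Equivalence.to (Conjuncts-⋀⇔∈ Θs hΘs))) ∘ choice-complete h⋀Θs hγ)
  (choice-sound ∘ map₂ (map₁ (Equivalence.from (Conjuncts-⋀⇔∈ Θs hΘs))))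
  where
  h⋀Θs : All ∧Mult (map ⋀ Θs)
  h⋀Θs = map⁺ (All.map (⋀-∧Mult _) hΘs)
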